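{- Every TI-scheme is a pseudo-TI scheme.
   Context: A coherent configuration on a finite set $\Omega$ is a pair $(\Omega,S)$, where $S$ is a partition of $\Omega\times\Omega$ such that the diagonal $1_\Omega$ is a union of elements of $S$, $S$ is closed under $s\mapsto s^*=\{(\beta,\alpha):(\alpha,\beta)\in s\}$, and for $r,s,t\in S$ the number $c_{rs}^t=|\alpha r\cap\beta s^*|$ (where $\alpha r=\{\beta:(\alpha,\beta)\in r\}$) does not depend on $(\alpha,\beta)\in t$. It is homogeneous if $1_\Omega\in S$; then $n_s=|\alpha s|$ is the valency of $s$ and $S_j=\{s\in S:n_s=j\}$. The indistinguishing number is $c=\max_{r\in S\setminus\{1_\Omega\}}\sum_{s\in S}c_{ss^*}^r$. With $k$ the maximum valency and $m=|S_1|$, a homogeneous coherent configuration is a pseudo-TI scheme if $S=S_1\cup S_k$ and $c\le mk$. A subgroup $H\le G$ is a TI-subgroup if $H^g\cap H\in\{H,1\}$ for all $g\in G$. A TI-scheme is the coherent configuration associated with some transitive permutation group $G\le\mathrm{Sym}(\Omega)$ (i.e. $S$ is the set of orbits of $G$ on $\Omega\times\Omega$) whose one-point stabilizer is a TI-subgroup of $G$. -}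

module Defs where

open import Level using (Level; suc; _⊔_) renaming (zero to lzero)
open import Data.Nat as ℕ using (ℕ; _+_; _*_; _≤_)
open import Data.Fin using (Fin; _≟_)
import Data.Fin as F
open import Data.Fin.Permutation using (Permutation′; _⟨$⟩ʳ_; id; flip; _∘ₚ_; _≈_)
open import Data.Product using (Σ; _×_; ∃; ∃-syntax; _,_)
open import Data.Sum using (_⊎_)
open import Relation.Binary.PropositionalEquality using (_≡_; _≢_)
open import Relation.Nullary using (Dec; does; ¬_)
open import Relation.Nullary.Decidable using (_×-dec_)
open import Function.Bundles using (_⇔_)
open import Data.Bool using (if_then_else_)

count : ∀ {n} {P : Fin n → Set} → ((i : Fin n) → Dec (P i)) → ℕ
count {ℕ.zero}  P? = 0
count {ℕ.suc n} P? = (if does (P? F.zero) then 1 else 0) + count (λ i → P? (F.suc i))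

sumF : ∀ {n} → (Fin n → ℕ) → ℕ
sumF {ℕ.zero}  f = 0
sumF {ℕ.suc n} f = f F.zero + sumF (λ i → f (F.suc i))

maxF : ∀ {n} → (Fin n → ℕ) → ℕ
maxF {ℕ.zero}  f = 0
maxF {ℕ.suc n} f = f F.zero ℕ.⊔ maxF (λ i → f (F.suc i))

-- A partition S of Fin n × Fin n into d classes is given by a surjective
-- colouring  col : Fin n → Fin n → Fin d ;  the class s ∈ Fin d is the
-- relation {(α,β) : col α β ≡ s}.

module Config {n d : ℕ} (col : Fin n → Fin n → Fin d) where

  -- c_{rs}^t evaluated at the pair (α,β) :  |α r ∩ β s*|
  -- (γ ∈ β s*  ⇔  (β,γ) ∈ s*  ⇔  (γ,β) ∈ s)
  isect : Fin d → Fin d → Fin n → Fin n → ℕ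
  isect r s α β = count (λ γ → (col α γ ≟ r) ×-dec (col γ β ≟ s))

  Surjective : Set
  Surjective = ∀ s → ∃[ α ] ∃[ β ] col α β ≡ s

  IsHomogeneousCC : Set
  IsHomogeneousCC =
      Surjective
    × (∃[ e ] ∀ α β → (col α β ≡ e ⇔ α ≡ β))
    × (∀ s → ∃[ s* ] ∀ α β → (col α β ≡ s ⇔ col β α ≡ s*))
    × (∀ r s t α β γ δ → col α β ≡ t → col γ δ ≡ t →
         isect r s α β ≡ isect r s γ δ)

  -- valency n_s = |x s|  (independent of x in a homogeneous configuration)
  valency : Fin n → Fin d → ℕ
  valency x s = count (λ β → col x β ≟ s)

  maxValency : Fin n → ℕ
  maxValency x = maxF (valency x)

  numThin : Fin n → ℕ
  numThin x = count (λ s → valency x s ℕ.≟ 1)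

  -- Σ_{s ∈ S} c_{s s*}^r evaluated at (α,β) ∈ r ;
  -- γ ∈ α s ∩ β s**  ⇔  col α γ ≡ s  and  (γ,β) ∈ s*, i.e. col β γ ≡ s
  indistAt : Fin n → Fin n → ℕ
  indistAt α β = sumF (λ s → count (λ γ → (col α γ ≟ s) ×-dec (col β γ ≟ s)))

  -- indistinguishing number c = max over r ≠ 1_Ω ; the relations r ≠ 1_Ω are
  -- exactly the classes of the off-diagonal pairs (α ≠ β)
  indist : ℕ
  indist = maxF (λ α → maxF (λ β → if? (α ≟ β)))
    where
    if? : ∀ {α β : Fin n} → Dec (α ≡ β) → ℕ
    if? {α} {β} p = if does p then 0 else indistAt α β

  -- pseudo-TI scheme (valencies computed at the base point x)
  IsPseudoTI : Fin n → Set
  IsPseudoTI x =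
      IsHomogeneousCC
    × (∀ s → valency x s ≡ 1 ⊎ valency x s ≡ maxValency x)
    × indist ≤ numThin x * maxValency x

record IsPermGroup {n : ℕ} (G : Permutation′ n → Set) : Set where
  field
    resp  : ∀ {g h} → g ≈ h → G g → G h
    hasId : G id
    close : ∀ {g h} → G g → G h → G (g ∘ₚ h)
    inv   : ∀ {g} → G g → G (flip g)

module _ {n : ℕ} (G : Permutation′ n → Set) where

  Transitive : Set
  Transitive = ∀ α β → ∃[ g ] G g × g ⟨$⟩ʳ α ≡ β

  Stab : Fin n → Permutation′ n → Set
  Stab α h = G h × h ⟨$⟩ʳ α ≡ α

  -- H^g = g⁻¹ H g ;  h ∈ H^g ⇔ g h g⁻¹ ∈ H  (composition ∘ₚ is diagrammatic:
  -- (a ∘ₚ b) ⟨$⟩ʳ x = b ⟨$⟩ʳ (a ⟨$⟩ʳ x))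
  Conj : (Permutation′ n → Set) → Permutation′ n → Permutation′ n → Set
  Conj H g h = H (flip g ∘ₚ h ∘ₚ g)

  -- H is a TI-subgroup of G : H^g ∩ H ∈ {H, 1} for all g ∈ G
  IsTI : (Permutation′ n → Set) → Set
  IsTI H = ∀ g → G g →
      (∀ h → G h → ((Conj H g h × H h) ⇔ H h))
    ⊎ (∀ h → G h → Conj H g h → H h → h ≈ id)

  IsOrbitalColouring : ∀ {d} → (Fin n → Fin n → Fin d) → Set
  IsOrbitalColouring col =
      (∀ s → ∃[ α ] ∃[ β ] col α β ≡ s)
    × (∀ α β γ δ → (col α β ≡ col γ δ ⇔ (∃[ g ] G g × g ⟨$⟩ʳ α ≡ γ × g ⟨$⟩ʳ β ≡ δ)))

-- Transitivity makes every point stabiliser a conjugate of the TI-subgroup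
-- G_α, so for any two points G_u ⊆ G_v or G_u ∩ G_v = 1.  Hence if G_α moves δ
-- then G_αδ = 1: every non-thin orbit of G_α is regular, and all non-thin
-- valencies are equal, to the maximum k.  For β ≠ α, the sum Σ_s c_{ss*}^r at
-- (α, β) counts the points γ with (α, γ) and (β, γ) in one relation, i.e. the
-- fixed points of the elements g with gα = β.  Fixing δ with G_αδ = 1, such a
-- g is determined by gδ, which takes at most k values; and an element g ∉ G_α
-- fixes at most m points, since conjugating a fixed point of g to α carries
-- all of them into the m fixed points of G_α.
module Submission where

open import Data.Bool using (if_then_else_)
open import Data.Empty using (⊥-elim)
open import Data.Fin as F using (Fin; _≟_)
open import Data.Fin.Permutation using (Permutation′; _⟨$⟩ʳ_; id; flip; _∘ₚ_; _≈_; inverseˡ; inverseʳ)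
open import Data.Fin.Properties using (suc-injective; 0≢1+n; any?)
open import Data.Nat as ℕ using (ℕ; zero; suc; _+_; _*_; _≤_; z≤n; s≤s)
open import Data.Nat.Properties
  using ( +-*-semiring; ≤-trans; ≤-antisym; m≤m+n; m≤n+m; m≤n⇒m≤1+n; +-mono-≤; +-identityʳ
        ; *-comm; *-monoˡ-≤; m≤m⊔n; m≤n⊔m; ⊔-lub; <⇒≢; module ≤-Reasoning)
open import Data.Product using (Σ; _×_; ∃; ∃-syntax; _,_; proj₁; proj₂)
open import Data.Sum using (_⊎_; inj₁; inj₂)
open import Function using (_∘_)
open import Function.Bundles using (_⇔_; mk⇔; Equivalence)
open import Relation.Binary.PropositionalEquality
open import Relation.Nullary using (Dec; yes; no; does; ¬_)
open import Relation.Nullary.Decidable using (_×-dec_; ¬?)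
open import Relation.Unary using (Decidable)

open import Algebra.Properties.Semiring.Sum +-*-semiring
  using (sum; ∑-comm; sum-cong-≗; sum-replicate-zero)

open import Defs

private
  variable
    n : ℕ

count-cong : {P Q : Fin n → Set} (P? : Decidable P) (Q? : Decidable Q) →
  (∀ i → P i → Q i) → (∀ i → Q i → P i) → count P? ≡ count Q?
count-cong {n = zero}  P? Q? P⇒Q Q⇒P = refl
count-cong {n = suc n} P? Q? P⇒Q Q⇒P with P? F.zero | Q? F.zero
... | yes p | yes q = cong suc (count-cong _ _ (λ i → P⇒Q (F.suc i)) (λ i → Q⇒P (F.suc i)))
... | yes p | no ¬q = ⊥-elim (¬q (P⇒Q _ p))
... | no ¬p | yes q = ⊥-elim (¬p (Q⇒P _ q))
... | no ¬p | no ¬q = count-cong _ _ (λ i → P⇒Q (F.suc i)) (λ i → Q⇒P (F.suc i))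

count-mono : {P Q : Fin n → Set} (P? : Decidable P) (Q? : Decidable Q) →
  (∀ i → P i → Q i) → count P? ≤ count Q?
count-mono {n = zero}  P? Q? P⇒Q = z≤n
count-mono {n = suc n} P? Q? P⇒Q with P? F.zero | Q? F.zero
... | yes p | yes q = s≤s (count-mono _ _ (λ i → P⇒Q (F.suc i)))
... | yes p | no ¬q = ⊥-elim (¬q (P⇒Q _ p))
... | no ¬p | yes q = m≤n⇒m≤1+n (count-mono _ _ (λ i → P⇒Q (F.suc i)))
... | no ¬p | no ¬q = count-mono _ _ (λ i → P⇒Q (F.suc i))

count-zero : {P : Fin n → Set} (P? : Decidable P) → (∀ i → ¬ P i) → count P? ≡ 0
count-zero {n = zero}  P? ¬P = refl
count-zero {n = suc n} P? ¬P with P? F.zero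
... | yes p = ⊥-elim (¬P _ p)
... | no _  = count-zero _ (λ i → ¬P (F.suc i))

count-remove : {P : Fin n → Set} (P? : Decidable P) {j : Fin n} → P j →
  count P? ≡ suc (count (λ i → P? i ×-dec ¬? (i ≟ j)))
count-remove {n = suc n} P? {F.zero} pj with P? F.zero
... | no ¬p = ⊥-elim (¬p pj)
... | yes _ = cong suc (count-cong (P? ∘ F.suc) (λ i → P? (F.suc i) ×-dec ¬? (F.suc i ≟ F.zero))
                                  (λ i p → p , λ ()) (λ i → proj₁))
count-remove {n = suc n} P? {F.suc j} pj
  with P? F.zero | count-remove (λ i → P? (F.suc i)) pj
     | count-cong (λ i → P? (F.suc i) ×-dec ¬? (i ≟ j))
                  (λ i → P? (F.suc i) ×-dec ¬? (F.suc i ≟ F.suc j))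
                  (λ i (p , i≢j) → p , λ e → i≢j (suc-injective e))
                  (λ i (p , si≢sj) → p , λ e → si≢sj (cong F.suc e))
... | yes _ | removed | shifted = cong suc (trans removed (cong suc shifted))
... | no _  | removed | shifted = trans removed (cong suc shifted)

count-≥1 : {P : Fin n → Set} (P? : Decidable P) {j : Fin n} → P j → 1 ≤ count P?
count-≥1 P? pj = subst (1 ≤_) (sym (count-remove P? pj)) (s≤s z≤n)

count-single : {P : Fin n → Set} (P? : Decidable P) {j : Fin n} → P j →
  (∀ i → P i → i ≡ j) → count P? ≡ 1
count-single P? pj unique = trans (count-remove P? pj)
  (cong suc (count-zero (λ i → P? i ×-dec ¬? (i ≟ _)) (λ i (p , i≢j) → i≢j (unique i p))))

count≡1⇒unique : {P : Fin n → Set} (P? : Decidable P) → count P? ≡ 1 →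
  ∀ {i j} → P i → P j → i ≡ j
count≡1⇒unique P? one {i} {j} pi pj with i ≟ j
... | yes i≡j = i≡j
... | no i≢j = ⊥-elim (<⇒≢ two≤count (sym one))
  where
  two≤count : 2 ≤ count P?
  two≤count = subst (2 ≤_) (sym (count-remove P? pj))
    (s≤s (count-≥1 (λ k → P? k ×-dec ¬? (k ≟ j)) (pi , i≢j)))

count-inj : ∀ {m} {P : Fin n → Set} {Q : Fin m → Set} (P? : Decidable P) (Q? : Decidable Q)
  (f : ∀ i → P i → Fin m) →
  (∀ i p → Q (f i p)) → (∀ i j p q → f i p ≡ f j q → i ≡ j) → count P? ≤ count Q?
count-inj {n = zero}  P? Q? f f∈Q f-inj = z≤n
count-inj {n = suc n} P? Q? f f∈Q f-inj with P? F.zero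
... | no _ = count-inj _ Q? (λ i → f (F.suc i)) (λ i → f∈Q (F.suc i))
               (λ i j p q e → suc-injective (f-inj _ _ p q e))
... | yes p₀ = subst (suc (count (λ i → P? (F.suc i))) ≤_) (sym (count-remove Q? (f∈Q F.zero p₀)))
      (s≤s (count-inj _ _ (λ i → f (F.suc i))
         (λ i p → f∈Q (F.suc i) p , λ e → 0≢1+n (sym (f-inj _ _ p p₀ e)))
         (λ i j p q e → suc-injective (f-inj _ _ p q e))))

indicator : ∀ {P : Set} → Dec P → ℕ
indicator P? = if does P? then 1 else 0

count≡sum : {P : Fin n → Set} (P? : Decidable P) → count P? ≡ sum (λ i → indicator (P? i))
count≡sum {n = zero}  P? = refl
count≡sum {n = suc n} P? = cong (indicator (P? F.zero) +_) (count≡sum (λ i → P? (F.suc i)))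

sumF≡sum : (f : Fin n → ℕ) → sumF f ≡ sum f
sumF≡sum {n = zero}  f = refl
sumF≡sum {n = suc n} f = cong (f F.zero +_) (sumF≡sum (λ i → f (F.suc i)))

sum-mono : {f g : Fin n → ℕ} → (∀ i → f i ≤ g i) → sum f ≤ sum g
sum-mono {n = zero}  f≤g = z≤n
sum-mono {n = suc n} f≤g = +-mono-≤ (f≤g F.zero) (sum-mono (λ i → f≤g (F.suc i)))

sum-single : (j : Fin n) (f : Fin n → ℕ) → (∀ i → i ≢ j → f i ≡ 0) → sum f ≡ f j
sum-single {n = suc n} F.zero f vanish =
  trans (cong (f F.zero +_) (trans (sum-cong-≗ (λ i → vanish (F.suc i) (λ ()))) (sum-replicate-zero n)))
    (+-identityʳ _)
sum-single {n = suc n} (F.suc j) f vanish =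
  trans (cong (_+ sum (f ∘ F.suc)) (vanish F.zero (λ ())))
    (sum-single j (f ∘ F.suc) (λ i i≢j → vanish (F.suc i) (λ e → i≢j (suc-injective e))))

indicator-yes : ∀ {P : Set} (P? : Dec P) → P → indicator P? ≡ 1
indicator-yes (yes _) _ = refl
indicator-yes (no ¬p) p = ⊥-elim (¬p p)

indicator-no : ∀ {P : Set} (P? : Dec P) → ¬ P → indicator P? ≡ 0
indicator-no (yes p) ¬p = ⊥-elim (¬p p)
indicator-no (no _)  _  = refl

indicator-cong : ∀ {P Q : Set} (P? : Dec P) (Q? : Dec Q) →
  (P → Q) → (Q → P) → indicator P? ≡ indicator Q?
indicator-cong (yes p) Q? P⇒Q Q⇒P = sym (indicator-yes Q? (P⇒Q p))
indicator-cong (no ¬p) Q? P⇒Q Q⇒P = sym (indicator-no Q? (λ q → ¬p (Q⇒P q)))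

term≤sum : (f : Fin n → ℕ) (j : Fin n) → f j ≤ sum f
term≤sum f F.zero    = m≤m+n _ _
term≤sum f (F.suc j) = ≤-trans (term≤sum (λ i → f (F.suc i)) j) (m≤n+m _ _)

count≤sum-count-cover : ∀ {d} {R : Fin n → Set} {S : Fin d → Fin n → Set}
  (R? : Decidable R) (S? : ∀ e → Decidable (S e)) →
  (∀ γ → R γ → ∃ λ e → S e γ) → count R? ≤ sum (λ e → count (S? e))
count≤sum-count-cover R? S? cover = begin
  count R?                                          ≡⟨ count≡sum R? ⟩
  sum (λ γ → indicator (R? γ))                      ≤⟨ sum-mono covered ⟩
  sum (λ γ → sum (λ e → indicator (S? e γ)))        ≡⟨ ∑-comm (λ γ e → indicator (S? e γ)) ⟩
  sum (λ e → sum (λ γ → indicator (S? e γ)))        ≡⟨ sum-cong-≗ (λ e → count≡sum (S? e)) ⟨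
  sum (λ e → count (S? e))                          ∎
  where
  open ≤-Reasoning
  covered : ∀ γ → indicator (R? γ) ≤ sum (λ e → indicator (S? e γ))
  covered γ with R? γ
  ... | no _  = z≤n
  ... | yes r = let (e , s) = cover γ r in
    subst (_≤ sum (λ e → indicator (S? e γ))) (indicator-yes (S? e γ) s) (term≤sum _ e)

sum-count-×-≤ : ∀ {d} {E : Fin d → Set} {S : Fin d → Fin n → Set}
  (E? : Decidable E) (S? : ∀ e → Decidable (S e)) {m : ℕ} →
  (∀ e → E e → count (S? e) ≤ m) → sum (λ e → count (λ γ → E? e ×-dec S? e γ)) ≤ count E? * m
sum-count-×-≤ {d = zero}  E? S? bound = z≤n
sum-count-×-≤ {d = suc d} E? S? bound
  with E? F.zero | sum-count-×-≤ (E? ∘ F.suc) (S? ∘ F.suc) (bound ∘ F.suc)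
... | yes e₀ | rest = +-mono-≤ (≤-trans (count-mono _ (S? F.zero) (λ γ → proj₂)) (bound F.zero e₀)) rest
... | no ¬e₀ | rest =
  subst (λ c → c + _ ≤ _) (sym (count-zero (λ γ → no ¬e₀ ×-dec S? F.zero γ) (λ γ → ¬e₀ ∘ proj₁))) rest

sum-count-fibres : ∀ {d} (f g : Fin n → Fin d) →
  sum (λ s → count (λ γ → (f γ ≟ s) ×-dec (g γ ≟ s))) ≡ count (λ γ → f γ ≟ g γ)
sum-count-fibres f g = begin
  sum (λ s → count (λ γ → both s γ))                 ≡⟨ sum-cong-≗ (λ s → count≡sum (both s)) ⟩
  sum (λ s → sum (λ γ → indicator (both s γ)))       ≡⟨ ∑-comm (λ s γ → indicator (both s γ)) ⟩
  sum (λ γ → sum (λ s → indicator (both s γ)))       ≡⟨ sum-cong-≗ only-fγ ⟩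
  sum (λ γ → indicator (f γ ≟ g γ))                  ≡⟨ count≡sum (λ γ → f γ ≟ g γ) ⟨
  count (λ γ → f γ ≟ g γ)                            ∎
  where
  open ≡-Reasoning
  both : ∀ s γ → Dec (f γ ≡ s × g γ ≡ s)
  both s γ = (f γ ≟ s) ×-dec (g γ ≟ s)
  only-fγ : ∀ γ → sum (λ s → indicator (both s γ)) ≡ indicator (f γ ≟ g γ)
  only-fγ γ = trans
    (sum-single (f γ) _ (λ s s≢fγ → indicator-no (both s γ) (λ (e , _) → s≢fγ (sym e))))
    (indicator-cong (both (f γ) γ) (f γ ≟ g γ) (λ (_ , e) → sym e) (λ e → refl , sym e))

maxF-upper : (f : Fin n → ℕ) (i : Fin n) → f i ≤ maxF f
maxF-upper f F.zero    = m≤m⊔n _ _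
maxF-upper f (F.suc i) = ≤-trans (maxF-upper (λ j → f (F.suc j)) i) (m≤n⊔m _ _)

maxF-lub : (f : Fin n → ℕ) {b : ℕ} → (∀ i → f i ≤ b) → maxF f ≤ b
maxF-lub {n = zero}  f f≤b = z≤n
maxF-lub {n = suc n} f f≤b = ⊔-lub (f≤b F.zero) (maxF-lub _ (λ i → f≤b (F.suc i)))

infixr 6 _·_
_·_ : Permutation′ n → Fin n → Fin n
g · x = g ⟨$⟩ʳ x

·-injective : ∀ (g : Permutation′ n) {x y} → g · x ≡ g · y → x ≡ y
·-injective g e = trans (sym (inverseˡ g)) (trans (cong (flip g ·_) e) (inverseˡ g))

flip-· : ∀ (g : Permutation′ n) {x y} → g · x ≡ y → flip g · y ≡ x
flip-· g refl = inverseˡ g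

conj : Permutation′ n → Permutation′ n → Permutation′ n
conj g h = flip g ∘ₚ h ∘ₚ g

conj-· : ∀ (g h : Permutation′ n) {x} → conj g h · (g · x) ≡ g · (h · x)
conj-· g h = cong (λ y → g · (h · y)) (inverseˡ g)

conj-fixes⇒fixes : ∀ (g h : Permutation′ n) {u w} → g · u ≡ w → conj g h · w ≡ w → h · u ≡ u
conj-fixes⇒fixes g h refl fixed = ·-injective g (trans (sym (conj-· g h)) fixed)

agree⇒quotient-fixes : ∀ (h₁ h₂ : Permutation′ n) {x} → h₁ · x ≡ h₂ · x → (h₁ ∘ₚ flip h₂) · x ≡ x
agree⇒quotient-fixes h₁ h₂ e = flip-· h₂ (sym e)

quotient-fixes⇒agree : ∀ (h₁ h₂ : Permutation′ n) {x} → (h₁ ∘ₚ flip h₂) · x ≡ x → h₁ · x ≡ h₂ · x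
quotient-fixes⇒agree h₁ h₂ e = trans (sym (inverseʳ h₂)) (cong (h₂ ·_) e)

count-≤-permute : {P Q : Fin n → Set} (P? : Decidable P) (Q? : Decidable Q)
  (g : Permutation′ n) → (∀ i → P i → Q (g · i)) → count P? ≤ count Q?
count-≤-permute P? Q? g g[P]⊆Q = count-inj P? Q? (λ i _ → g · i) g[P]⊆Q (λ _ _ _ _ → ·-injective g)

module OrbitalConfiguration {n : ℕ} {G : Permutation′ n → Set} (isGroup : IsPermGroup G)
  (transitive : Transitive G) {d : ℕ} {col : Fin n → Fin n → Fin d}
  (orbital : IsOrbitalColouring G col) where

  open IsPermGroup isGroup
  open Config col

  sameColour⇒mapped : ∀ {a b c e} → col a b ≡ col c e → ∃[ g ] G g × g · a ≡ c × g · b ≡ e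
  sameColour⇒mapped = Equivalence.to (proj₂ orbital _ _ _ _)

  mapped⇒sameColour : ∀ {g a b c e} → G g → g · a ≡ c → g · b ≡ e → col a b ≡ col c e
  mapped⇒sameColour {g} g∈G ga≡c gb≡e = Equivalence.from (proj₂ orbital _ _ _ _) (g , g∈G , ga≡c , gb≡e)

  conj-∈Stab : ∀ {g h u w} → G g → Stab G u h → g · u ≡ w → Stab G w (conj g h)
  conj-∈Stab {g} {h} g∈G (h∈G , hu≡u) refl =
    close (inv g∈G) (close h∈G g∈G) , trans (conj-· g h) (cong (g ·_) hu≡u)

  isect-≤ : ∀ r s {a b c e} → col a b ≡ col c e → isect r s a b ≤ isect r s c e
  isect-≤ r s same with sameColour⇒mapped same
  ... | g , g∈G , refl , refl = count-≤-permute _ _ g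
        (λ γ (r-edge , s-edge) → trans (sym (mapped⇒sameColour g∈G refl refl)) r-edge
                               , trans (sym (mapped⇒sameColour g∈G refl refl)) s-edge)

  homogeneous : Fin n → IsHomogeneousCC
  homogeneous α = proj₁ orbital
    , (col α α , λ a b → mk⇔ (diagonal⇒≡ a b) (≡⇒diagonal a b))
    , converse
    , (λ r s t a b c e ab∈t ce∈t →
         ≤-antisym (isect-≤ r s (trans ab∈t (sym ce∈t))) (isect-≤ r s (trans ce∈t (sym ab∈t))))
    where
    diagonal⇒≡ : ∀ a b → col a b ≡ col α α → a ≡ b
    diagonal⇒≡ a b same with sameColour⇒mapped same
    ... | g , _ , ga≡α , gb≡α = ·-injective g (trans ga≡α (sym gb≡α))
    ≡⇒diagonal : ∀ a b → a ≡ b → col a b ≡ col α α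
    ≡⇒diagonal a .a refl with transitive α a
    ... | g , g∈G , gα≡a = sym (mapped⇒sameColour g∈G gα≡a gα≡a)
    converse : ∀ s → ∃[ s* ] ∀ a b → (col a b ≡ s ⇔ col b a ≡ s*)
    converse s with proj₁ orbital s
    ... | a₀ , b₀ , refl = col b₀ a₀ , λ a b → mk⇔ (swap a b) (swap b a)
      where
      swap : ∀ a b {c e} → col a b ≡ col c e → col b a ≡ col e c
      swap a b same with sameColour⇒mapped same
      ... | g , g∈G , ga≡c , gb≡e = mapped⇒sameColour g∈G gb≡e ga≡c

  valency-≤ : ∀ a b s → valency a s ≤ valency b s
  valency-≤ a b s with transitive a b
  ... | g , g∈G , ga≡b =
    count-≤-permute _ _ g (λ γ aγ∈s → trans (sym (mapped⇒sameColour g∈G ga≡b refl)) aγ∈s)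

  transporters : ∀ a b c → Σ (Fin n → Permutation′ n) λ p →
    ∀ {e} → col a b ≡ col c e → G (p e) × p e · a ≡ c × p e · b ≡ e
  transporters a b c = (λ e → pick (col a b ≟ col c e)) , λ {e} → spec (col a b ≟ col c e)
    where
    pick : ∀ {e} → Dec (col a b ≡ col c e) → Permutation′ n
    pick (yes same) = proj₁ (sameColour⇒mapped same)
    pick (no _)     = id
    spec : ∀ {e} (same? : Dec (col a b ≡ col c e)) → col a b ≡ col c e →
      G (pick same?) × pick same? · a ≡ c × pick same? · b ≡ e
    spec (yes same) _    = proj₂ (sameColour⇒mapped same)
    spec (no ¬same) same = ⊥-elim (¬same same)

  module AtPoint (α : Fin n) where

    representative : ∀ s → ∃[ δ ] col α δ ≡ s
    representative s with proj₁ orbital s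
    ... | a , b , refl with transitive a α
    ... | g , g∈G , ga≡α = g · b , sym (mapped⇒sameColour g∈G ga≡α refl)

    thin⇒fixed : ∀ {x h} → valency α (col α x) ≡ 1 → Stab G α h → h · x ≡ x
    thin⇒fixed {x} thin (h∈G , hα≡α) =
      count≡1⇒unique (λ β → col α β ≟ col α x) thin (sym (mapped⇒sameColour h∈G hα≡α refl)) refl

    fixed⇒thin : ∀ {x} → (∀ {h} → Stab G α h → h · x ≡ x) → valency α (col α x) ≡ 1
    fixed⇒thin {x} fixed = count-single (λ β → col α β ≟ col α x) refl unique
      where
      unique : ∀ y → col α y ≡ col α x → y ≡ x
      unique y same with sameColour⇒mapped (sym same)
      ... | h , h∈G , hα≡α , hx≡y = trans (sym hx≡y) (fixed (h∈G , hα≡α))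

    nonthin⇒moved : ∀ {x} → valency α (col α x) ≢ 1 → ∃[ h ] Stab G α h × h · x ≢ x
    nonthin⇒moved {x} nonthin with any? (λ y → (col α y ≟ col α x) ×-dec ¬? (y ≟ x))
    ... | yes (y , same , y≢x) = let (h , h∈G , hα≡α , hx≡y) = sameColour⇒mapped (sym same) in
      h , (h∈G , hα≡α) , λ hx≡x → y≢x (trans (sym hx≡y) hx≡x)
    ... | no ¬other = ⊥-elim (nonthin (count-single (λ β → col α β ≟ col α x) refl unique))
      where
      unique : ∀ y → col α y ≡ col α x → y ≡ x
      unique y same with y ≟ x
      ... | yes y≡x = y≡x
      ... | no y≢x = ⊥-elim (¬other (y , same , y≢x))

    Regular : Fin n → Set
    Regular δ = ∀ {q} → Stab G α q → q · δ ≡ δ → q ≈ id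

    regular⇒transport-unique : ∀ {δ h₁ h₂} → Regular δ → G h₁ → G h₂ →
      h₁ · α ≡ h₂ · α → h₁ · δ ≡ h₂ · δ → ∀ z → h₁ · z ≡ h₂ · z
    regular⇒transport-unique {h₁ = h₁} {h₂} regular h₁∈G h₂∈G agreeα agreeδ z =
      quotient-fixes⇒agree h₁ h₂
        (regular (close h₁∈G (inv h₂∈G) , agree⇒quotient-fixes h₁ h₂ agreeα)
                 (agree⇒quotient-fixes h₁ h₂ agreeδ) z)

    regular-valency-max : ∀ {δ} → Regular δ → ∀ s → valency α s ≤ valency α (col α δ)
    regular-valency-max {δ} regular s with representative s
    ... | δₛ , refl = count-inj (λ β → col α β ≟ col α δₛ) (λ β → col α β ≟ col α δ)
                        (λ γ γ∈s → proj₁ (stabiliser γ∈s) · δ) image∈ injective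
      where
      stabiliser : ∀ {γ} → col α γ ≡ col α δₛ → ∃[ h ] G h × h · α ≡ α × h · δₛ ≡ γ
      stabiliser γ∈s = sameColour⇒mapped (sym γ∈s)
      image∈ : ∀ γ γ∈s → col α (proj₁ (stabiliser {γ} γ∈s) · δ) ≡ col α δ
      image∈ γ γ∈s with stabiliser γ∈s
      ... | h , h∈G , hα≡α , _ = sym (mapped⇒sameColour h∈G hα≡α refl)
      injective : ∀ γ₁ γ₂ γ₁∈s γ₂∈s →
        proj₁ (stabiliser {γ₁} γ₁∈s) · δ ≡ proj₁ (stabiliser {γ₂} γ₂∈s) · δ → γ₁ ≡ γ₂
      injective γ₁ γ₂ γ₁∈s γ₂∈s agreeδ with stabiliser γ₁∈s | stabiliser γ₂∈s
      ... | h₁ , h₁∈G , h₁α≡α , h₁δₛ≡γ₁ | h₂ , h₂∈G , h₂α≡α , h₂δₛ≡γ₂ =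
        trans (sym h₁δₛ≡γ₁) (trans (agree δₛ) h₂δₛ≡γ₂)
        where
        agree = regular⇒transport-unique regular h₁∈G h₂∈G (trans h₁α≡α (sym h₂α≡α)) agreeδ

    thinPoints≤numThin : count (λ x → valency α (col α x) ℕ.≟ 1) ≤ numThin α
    thinPoints≤numThin = count-inj _ _ (λ x _ → col α x) (λ _ thin → thin) injective
      where
      injective : ∀ x y → valency α (col α x) ≡ 1 → valency α (col α y) ≡ 1 → col α x ≡ col α y → x ≡ y
      injective x y thin _ same with sameColour⇒mapped same
      ... | h , h∈G , hα≡α , hx≡y = trans (sym (thin⇒fixed thin (h∈G , hα≡α))) hx≡y

  module TI (α : Fin n) (ti : IsTI G (Stab G α)) where

    open AtPoint α

    stabilizer-TI-at-base : ∀ {v h q} → Stab G α h → h · v ≢ v → Stab G α q → q · v ≡ v → q ≈ id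
    stabilizer-TI-at-base {v} {h} {q} h∈Gα hv≢v (q∈G , qα≡α) qv≡v with transitive v α
    ... | g , g∈G , gv≡α with ti g g∈G
    ... | inj₁ Gα⊆Gα^g = ⊥-elim (hv≢v (conj-fixes⇒fixes g h gv≡α conj-h-fixes-α))
      where
      conj-h-fixes-α : conj g h · α ≡ α
      conj-h-fixes-α = proj₂ (proj₁ (Equivalence.from (Gα⊆Gα^g h (proj₁ h∈Gα)) h∈Gα))
    ... | inj₂ Gα∩Gα^g≡1 = Gα∩Gα^g≡1 q q∈G (conj-∈Stab g∈G (q∈G , qv≡v) gv≡α) (q∈G , qα≡α)

    stabilizer-TI : ∀ {u v h q} → Stab G u h → h · v ≢ v → Stab G u q → q · v ≡ v → q ≈ id
    stabilizer-TI {u} {v} {h} {q} h∈Gu hv≢v q∈Gu qv≡v z with transitive u α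
    ... | c , c∈G , cu≡α = ·-injective c (trans (sym (conj-· c q)) (conj-q-trivial (c · z)))
      where
      conj-q-trivial : conj c q ≈ id
      conj-q-trivial = stabilizer-TI-at-base (conj-∈Stab c∈G h∈Gu cu≡α)
        (λ fixed → hv≢v (conj-fixes⇒fixes c h refl fixed))
        (conj-∈Stab c∈G q∈Gu cu≡α) (trans (conj-· c q) (cong (c ·_) qv≡v))

    nonthin⇒regular : ∀ {δ} → valency α (col α δ) ≢ 1 → Regular δ
    nonthin⇒regular nonthin with nonthin⇒moved nonthin
    ... | h , h∈Gα , hδ≢δ = stabilizer-TI-at-base h∈Gα hδ≢δ

    regular-exists : ∃ Regular
    regular-exists with any? (λ s → ¬? (valency α s ℕ.≟ 1))
    ... | yes (s , nonthin) with representative s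
    ...   | δ , refl = δ , nonthin⇒regular nonthin
    regular-exists | no ¬nonthin = α , λ q∈Gα _ z → thin⇒fixed (all-thin (col α z)) q∈Gα
      where
      all-thin : ∀ s → valency α s ≡ 1
      all-thin s with valency α s ℕ.≟ 1
      ... | yes thin = thin
      ... | no nonthin = ⊥-elim (¬nonthin (s , nonthin))

    valency-thin-or-max : ∀ s → valency α s ≡ 1 ⊎ valency α s ≡ maxValency α
    valency-thin-or-max s with representative s
    ... | δ , refl with valency α (col α δ) ℕ.≟ 1
    ...   | yes thin = inj₁ thin
    ...   | no nonthin = inj₂ (≤-antisym (maxF-upper (valency α) (col α δ))
                                         (maxF-lub (valency α) (regular-valency-max (nonthin⇒regular nonthin))))

    fixedPoints≤numThin : ∀ {p} → G p → p · α ≢ α → count (λ γ → p · γ ≟ γ) ≤ numThin α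
    fixedPoints≤numThin {p} p∈G pα≢α with any? (λ γ → p · γ ≟ γ)
    ... | no ¬fixed = subst (_≤ numThin α)
          (sym (count-zero (λ γ → p · γ ≟ γ) (λ γ pγ≡γ → ¬fixed (γ , pγ≡γ)))) z≤n
    ... | yes (γ₀ , pγ₀≡γ₀) with transitive γ₀ α
    ...   | w , w∈G , wγ₀≡α = ≤-trans (count-≤-permute _ _ w thin) thinPoints≤numThin
      where
      thin : ∀ γ → p · γ ≡ γ → valency α (col α (w · γ)) ≡ 1
      thin γ pγ≡γ = fixed⇒thin fixed
        where
        fixed : ∀ {h} → Stab G α h → h · (w · γ) ≡ w · γ
        fixed {h} h∈Gα with h · (w · γ) ≟ w · γ
        ... | yes hwγ≡wγ = hwγ≡wγ
        ... | no hwγ≢wγ = ⊥-elim (pα≢α (stabilizer-TI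
              (conj-∈Stab (inv w∈G) h∈Gα (flip-· w wγ₀≡α))
              (λ fixed → hwγ≢wγ (conj-fixes⇒fixes (flip w) h (inverseˡ w) fixed))
              (p∈G , pγ₀≡γ₀) pγ≡γ α))

    agreements≤numThin*maxValency : ∀ {b} → b ≢ α →
      count (λ γ → col α γ ≟ col b γ) ≤ numThin α * maxValency α
    agreements≤numThin*maxValency {b} b≢α with regular-exists
    ... | δ , regular = begin
      count (λ γ → col α γ ≟ col b γ)   ≤⟨ count≤sum-count-cover _ S? covered ⟩
      sum (λ ε → count (S? ε))          ≤⟨ sum-count-×-≤ E? (λ ε γ → p ε · γ ≟ γ) fixedPoints≤m ⟩
      count E? * m                      ≤⟨ *-monoˡ-≤ m E≤k ⟩
      k * m                             ≡⟨ *-comm k m ⟩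
      m * k                             ∎
      where
      open ≤-Reasoning
      m = numThin α
      k = maxValency α
      p = proj₁ (transporters α δ b)
      p-spec = proj₂ (transporters α δ b)
      E? : ∀ ε → Dec (col α δ ≡ col b ε)
      E? ε = col α δ ≟ col b ε
      S? : ∀ ε γ → Dec (col α δ ≡ col b ε × p ε · γ ≡ γ)
      S? ε γ = E? ε ×-dec (p ε · γ ≟ γ)
      covered : ∀ γ → col α γ ≡ col b γ → ∃ λ ε → col α δ ≡ col b ε × p ε · γ ≡ γ
      covered γ same with sameColour⇒mapped same
      ... | g , g∈G , gα≡b , gγ≡γ =
        let gδ∈E = mapped⇒sameColour g∈G gα≡b refl
            (p∈G , pα≡b , pδ≡gδ) = p-spec gδ∈E
        in g · δ , gδ∈E
         , trans (regular⇒transport-unique regular p∈G g∈G (trans pα≡b (sym gα≡b)) pδ≡gδ γ) gγ≡γ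
      fixedPoints≤m : ∀ ε → col α δ ≡ col b ε → count (λ γ → p ε · γ ≟ γ) ≤ m
      fixedPoints≤m ε ε∈E = let (p∈G , pα≡b , _) = p-spec ε∈E in
        fixedPoints≤numThin p∈G (λ pα≡α → b≢α (trans (sym pα≡b) pα≡α))
      E≤k : count E? ≤ k
      E≤k = begin
        count E?                    ≡⟨ count-cong E? (λ ε → col b ε ≟ col α δ) (λ _ → sym) (λ _ → sym) ⟩
        valency b (col α δ)         ≤⟨ valency-≤ b α (col α δ) ⟩
        valency α (col α δ)         ≤⟨ maxF-upper (valency α) (col α δ) ⟩
        k                           ∎

    indistAt≤numThin*maxValency : ∀ {a b} → a ≢ b → indistAt a b ≤ numThin α * maxValency α
    indistAt≤numThin*maxValency {a} {b} a≢b with transitive a α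
    ... | g , g∈G , ga≡α = begin
      indistAt a b                           ≡⟨ sumF≡sum fibreSizes ⟩
      sum fibreSizes                         ≡⟨ sum-count-fibres (col a) (col b) ⟩
      count (λ γ → col a γ ≟ col b γ)        ≤⟨ count-≤-permute _ _ g moved ⟩
      count (λ γ → col α γ ≟ col (g · b) γ)  ≤⟨ agreements≤numThin*maxValency gb≢α ⟩
      numThin α * maxValency α               ∎
      where
      open ≤-Reasoning
      fibreSizes : Fin d → ℕ
      fibreSizes s = count (λ γ → (col a γ ≟ s) ×-dec (col b γ ≟ s))
      moved : ∀ γ → col a γ ≡ col b γ → col α (g · γ) ≡ col (g · b) (g · γ)
      moved γ same =
        trans (sym (mapped⇒sameColour g∈G ga≡α refl)) (trans same (mapped⇒sameColour g∈G refl refl))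
      gb≢α : g · b ≢ α
      gb≢α gb≡α = a≢b (·-injective g (trans ga≡α (sym gb≡α)))

    indist≤numThin*maxValency : indist ≤ numThin α * maxValency α
    indist≤numThin*maxValency = maxF-lub _ (λ a → maxF-lub _ (λ b → offDiagonal (a ≟ b)))
      where
      -- the summand of Config.indist, with its local if? unfolded
      offDiagonal : ∀ {a b} (a≟b : Dec (a ≡ b)) →
        (if does a≟b then 0 else indistAt a b) ≤ numThin α * maxValency α
      offDiagonal (yes _)  = z≤n
      offDiagonal (no a≢b) = indistAt≤numThin*maxValency a≢b

theorem3p5 : (n : ℕ) (G : Permutation′ n → Set) → IsPermGroup G → Transitive G →
    (α : Fin n) → IsTI G (Stab G α) →
    (d : ℕ) (col : Fin n → Fin n → Fin d) → IsOrbitalColouring G col →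
    Config.IsPseudoTI col α
theorem3p5 n G isGroup transitive α ti d col orbital =
  homogeneous α , valency-thin-or-max , indist≤numThin*maxValency
  where
  open OrbitalConfiguration isGroup transitive orbital
  open TI α ti
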